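{- Let $X$ be a robust $X$-set parameter and let $\mathcal{B}_X$ be an inclusive component consistent $X$-irredundant blocking family for $X$. Let $G$ and $G'$ be graphs such that the XIr-TAR graphs of $G$ and $G'$ (with respect to $\mathcal{B}_X$) are isomorphic. If $\operatorname{XIR}(K_1)=1$ or $G$ and $G'$ have no isolated vertices, then $G$ and $G'$ have the same order and there is a relabeling of the vertices of $G'$ such that $G$ and $G'$ have exactly the same XIr-sets.
   Context: All graphs are finite, simple, undirected, with nonempty vertex set. A super $X$-set parameter $X$ is specified by a property of vertex subsets (the "$X$-sets"), preserved under graph isomorphisms, such that every graph has at least one $X$-set and every superset of an $X$-set is an $X$-set. $X$ is component consistent if for every graph $G$ with connected components $G_1,\dots,G_k$, $S\subseteq V(G)$ is an $X$-set of $G$ iff $S\cap V(G_i)$ is an $X$-set of $G_i$ for each $i$. $X$ is robust if it is component consistent and, for every connected graph $G$ of order $n\ge 2$, every set of $n-1$ vertices is an $X$-set. A set $R\subseteq V(G)$ is an $X$-blocking set if $V(G)\setminus R$ is not an $X$-set. An $X$-blocking family $\mathcal{B}_X$ assigns to each graph $G$ a set $B_X(G)$ of $X$-blocking sets of $G$, compatible with isomorphism (if $G\cong H$ then after relabeling $B_X(G)=B_X(H)$). $\mathcal{B}_X$ is $X$-irredundant if for every $G$ and $S\subseteq V(G)$: $S$ is an $X$-set iff $S\cap R\ne\emptyset$ for all $R\in B_X(G)$. $\mathcal{B}_X$ is component consistent if for every graph $G$ with components $G_1,\dots,G_k$: (1) $R_i\in B_X(G_i)$ implies $R_i\in B_X(G)$;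 (2) $R\in B_X(G)$ implies that for each $i$, $R\cap V(G_i)\in B_X(G_i)$ or $R\cap V(G_i)=\emptyset$. A component consistent $\mathcal{B}_X$ is inclusive if for every connected graph $G$ of order at least two and every $v\in V(G)$ there is $R\in B_X(G)$ with $v\in R$. For $S\subseteq V(G)$, $u\in S$, a set $R\in B_X(G)$ is private for $u$ relative to $S$ if $S\cap R=\{u\}$; $S$ is an XIr-set if every element of $S$ has a private set. $\operatorname{XIR}(G)$ is the maximum cardinality of an XIr-set of $G$. The XIr-TAR graph of $G$ has as vertices the XIr-sets of $G$, two being adjacent iff one is obtained from the other by adding or removing exactly one vertex. -}

module Defs where

open import Data.Nat using (ℕ; zero; suc; _<_; _≤_)
open import Data.Bool using (Bool; true; false)
open import Data.Fin using (Fin)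
open import Data.Fin.Subset using (Subset; _∈_; _∉_; _∩_; _∪_; ⁅_⁆; ∁; _⊆_; Nonempty; Empty; ∣_∣)
open import Data.Vec using (lookup; tabulate)
open import Data.Product using (Σ; ∃; ∃-syntax; _×_; _,_)
open import Data.Sum using (_⊎_)
open import Relation.Binary.PropositionalEquality using (_≡_)
open import Relation.Nullary using (¬_)
open import Function.Bundles using (_↔_; _⇔_; Inverse)

record Graph : Set where
  field
    order    : ℕ
    nonempty : 0 < order
    adj      : Fin order → Fin order → Bool
    adj-sym  : ∀ u v → adj u v ≡ adj v u
    adj-irr  : ∀ v → adj v v ≡ false

open Graph public

V : Graph → Set
V G = Fin (order G)

K₁ : Graph
K₁ = record
  { order = 1 ; nonempty = Data.Nat.s≤s Data.Nat.z≤n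
  ; adj = λ _ _ → false ; adj-sym = λ _ _ → Relation.Binary.PropositionalEquality.refl
  ; adj-irr = λ _ → Relation.Binary.PropositionalEquality.refl }

data Reach (G : Graph) : V G → V G → Set where
  here : ∀ {v} → Reach G v v
  step : ∀ {u w v} → adj G u w ≡ true → Reach G w v → Reach G u v

Connected : Graph → Set
Connected G = ∀ (u v : V G) → Reach G u v

IsolatedVertex : (G : Graph) → V G → Set
IsolatedVertex G v = ∀ (u : V G) → adj G v u ≡ false

NoIsolatedVertices : Graph → Set
NoIsolatedVertices G = ∀ (v : V G) → ¬ IsolatedVertex G v

image : ∀ {n m} → (Fin n ↔ Fin m) → Subset n → Subset m
image σ S = tabulate (λ w → lookup S (Inverse.from σ w))

record Iso (G H : Graph) : Set where
  field
    bij   : V G ↔ V H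
    preserves : ∀ (u v : V G) →
      adj H (Inverse.to bij u) (Inverse.to bij v) ≡ adj G u v

-- A connected component of G, presented as a (connected) graph H together
-- with an injective embedding onto a vertex set C of G such that H is the
-- subgraph of G induced by C, and C is closed under adjacency
-- (hence a maximal connected vertex set, i.e. a component).
record Component (G : Graph) : Set where
  field
    H         : Graph
    emb       : V H → V G
    emb-inj   : ∀ i j → emb i ≡ emb j → i ≡ j
    emb-adj   : ∀ i j → adj H i j ≡ adj G (emb i) (emb j)
    H-conn    : Connected H
    closed    : ∀ (i : V H) (v : V G) → adj G (emb i) v ≡ true → ∃[ j ] emb j ≡ v

open Component public

restrict : ∀ {G} (c : Component G) → Subset (order G) → Subset (order (H c))
restrict c S = tabulate (λ i → lookup S (emb c i))

IsLift : ∀ {G} (c : Component G) → Subset (order (H c)) → Subset (order G) → Set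
IsLift {G} c R' T = ∀ (v : V G) → (v ∈ T) ⇔ (∃[ i ] (emb c i ≡ v × i ∈ R'))

record SuperXParam : Set₁ where
  field
    IsX        : (G : Graph) → Subset (order G) → Set
    iso-inv    : ∀ {G H} (φ : Iso G H) (S : Subset (order G)) →
                 IsX G S → IsX H (image (Iso.bij φ) S)
    exists     : ∀ G → ∃[ S ] IsX G S
    upward     : ∀ {G} {S T : Subset (order G)} → S ⊆ T → IsX G S → IsX G T

module _ (X : SuperXParam) where
  open SuperXParam X

  XComponentConsistent : Set
  XComponentConsistent = ∀ (G : Graph) (S : Subset (order G)) →
    IsX G S ⇔ (∀ (c : Component G) → IsX (H c) (restrict c S))

  Robust : Set
  Robust = XComponentConsistent ×
    (∀ (G : Graph) → Connected G → 2 ≤ order G →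
       ∀ (v : V G) → IsX G (∁ ⁅ v ⁆))

  XBlocking : (G : Graph) → Subset (order G) → Set
  XBlocking G R = ¬ IsX G (∁ R)

  -- X-blocking families: B G R means R ∈ B_X(G).
  record BlockingFamily : Set₁ where
    field
      B         : (G : Graph) → Subset (order G) → Set
      blocking  : ∀ G R → B G R → XBlocking G R
      iso-compat : ∀ {G H} (φ : Iso G H) (R : Subset (order G)) →
                   B G R → B H (image (Iso.bij φ) R)

  module _ (𝓑 : BlockingFamily) where
    open BlockingFamily 𝓑

    Irredundant : Set
    Irredundant = ∀ (G : Graph) (S : Subset (order G)) →
      IsX G S ⇔ (∀ R → B G R → Nonempty (S ∩ R))

    BComponentConsistent : Set
    BComponentConsistent =
      (∀ G (c : Component G) (R' : Subset (order (H c))) → B (H c) R' →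
         ∀ T → IsLift c R' T → B G T) ×
      (∀ G (R : Subset (order G)) → B G R →
         ∀ (c : Component G) → B (H c) (restrict c R) ⊎ Empty (restrict c R))

    Inclusive : Set
    Inclusive = BComponentConsistent ×
      (∀ (G : Graph) → Connected G → 2 ≤ order G →
         ∀ (v : V G) → ∃[ R ] (B G R × v ∈ R))

    Private : (G : Graph) → Subset (order G) → V G → Subset (order G) → Set
    Private G S u R = B G R × (S ∩ R ≡ ⁅ u ⁆)

    XIr : (G : Graph) → Subset (order G) → Set
    XIr G S = ∀ u → u ∈ S → ∃[ R ] Private G S u R

    IsXIR : Graph → ℕ → Set
    IsXIR G k = (∃[ S ] (XIr G S × ∣ S ∣ ≡ k)) ×
                (∀ S → XIr G S → ∣ S ∣ ≤ k)

    TARAdj : ∀ {n} → Subset n → Subset n → Set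
    TARAdj S T = ∃[ v ] ((v ∉ S × T ≡ S ∪ ⁅ v ⁆) ⊎ (v ∉ T × S ≡ T ∪ ⁅ v ⁆))

    record TARIso (G G' : Graph) : Set where
      field
        f     : Subset (order G) → Subset (order G')
        g     : Subset (order G') → Subset (order G)
        f-XIr : ∀ S → XIr G S → XIr G' (f S)
        g-XIr : ∀ T → XIr G' T → XIr G (g T)
        gf    : ∀ S → XIr G S → g (f S) ≡ S
        fg    : ∀ T → XIr G' T → f (g T) ≡ T
        f-adj : ∀ S S' → XIr G S → XIr G S' → TARAdj S S' ⇔ TARAdj (f S) (f S')

-- The XIr-sets of a graph form a simplicial complex: they are closed under subsets, and
-- every singleton {v} is an XIr-set because some blocking set contains v — by
-- inclusiveness on the component of v, or, for isolated v, because XIR(K₁) = 1 yields a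
-- blocking set of K₁, which lifts to the component {v}.  The XIr-TAR graph is the token
-- addition/removal graph of this complex, and that graph determines the complex: a TAR
-- isomorphism φ sends {v} to φ(∅) Δ {σ v} for an injection σ, and by induction on |S|,
-- comparing the two descriptions of φ(S) obtained from S − u and S − w, φ(S) = φ(∅) Δ σ(S)
-- for every face S.  Applied to φ and φ⁻¹ this makes σ a bijection carrying faces exactly
-- onto faces.

module Submission where

open import Data.Nat using (ℕ; zero; suc; _≤_; _<_; s≤s; z≤n; >-nonZero⁻¹)
open import Data.Nat.Properties using (<-irrefl; ≤-trans; ≤-reflexive; <⇒≱)
open import Data.Bool using (Bool; true; false; not; _xor_; _∨_; _∧_)
open import Data.Bool.Properties using (¬-not; xor-comm; xor-assoc; xor-same; xor-identityˡ; xor-identityʳ; ∨-identityʳ) renaming (_≟_ to _≟ᵇ_)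
open import Data.Fin using (Fin; zero; suc; punchOut)
open import Data.Fin.Properties using (_≟_; suc-injective; nonZeroIndex; any?; injective⇒≤; punchOut-injective; cantor-schröder-bernstein)
open import Data.Fin.Subset using (Subset; ∣_∣; _∈_; _∉_; _∪_; _∩_; ∁; _─_; _-_; ⁅_⁆; _⊆_; _⊂_; ⊥)
open import Data.Fin.Subset.Properties using (_∈?_; ⊆-antisym; x∈p∩q⁺; x∈p∩q⁻; ∉⊥; ∣⁅x⁆∣≡1; ∣p∣≤n; p⊂q⇒∣p∣<∣q∣; p∩q⊆p; nonempty?; Empty-unique; x∈⁅x⁆; x∈⁅y⁆⇒x≡y; p─q⊆p; x∈p⇒p-x⊂p; x∈p∧x≢y⇒x∈p-y; ⊂-trans)
open import Data.Fin.Subset.Induction using (⊂-wellFounded)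
open import Data.Vec using ([]; _∷_; here; there; lookup; tabulate; zipWith)
open import Data.Vec.Properties using (lookup∘tabulate; tabulate∘lookup; tabulate-cong; lookup-zipWith; lookup-map; lookup-replicate; []=⇒lookup; lookup⇒[]=)
open import Data.Vec.Relation.Binary.Pointwise.Inductive using (Pointwise-≡⇒≡; zipWith-assoc; zipWith-identityˡ; zipWith-identityʳ)
open import Data.Product using (Σ; ∃-syntax; _×_; _,_; proj₁; proj₂)
open import Data.Sum using (_⊎_; inj₁; inj₂; map₂)
open import Function using (_∘_)
open import Function.Bundles using (_↔_; _⇔_; Inverse; Equivalence; mk⇔; mk↔ₛ′)
open import Function.Definitions using (Injective)
open import Induction.WellFounded using (Acc; acc)
open import Relation.Binary.PropositionalEquality using (_≡_; _≢_; refl; sym; trans; cong; cong₂; subst; subst₂; module ≡-Reasoning)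
open import Relation.Nullary using (yes; no; does; contradiction)
open import Relation.Nullary.Decidable using (dec-true; decidable-stable; _⊎-dec_; _×-dec_; ¬?)
open import Relation.Unary using (Decidable)

open import Defs using (Graph; V; order; adj; adj-sym; adj-irr; Reach; here; step; Connected; Component; K₁; IsolatedVertex; NoIsolatedVertices; H; emb; IsLift; image;
  SuperXParam; BlockingFamily; XIr; IsXIR; TARAdj; TARIso; BComponentConsistent; Inclusive; Robust; Irredundant)

private
  variable
    n n' : ℕ

infixl 6 _⊕_

_⊕_ : Subset n → Subset n → Subset n
p ⊕ q = zipWith _xor_ p q

subset-ext : {p q : Subset n} → (∀ i → lookup p i ≡ lookup q i) → p ≡ q
subset-ext {p = p} {q} eq = trans (sym (tabulate∘lookup p)) (trans (tabulate-cong eq) (tabulate∘lookup q))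

∈⇒lookup : {x : Fin n} {p : Subset n} → x ∈ p → lookup p x ≡ true
∈⇒lookup = []=⇒lookup

lookup⇒∈ : {x : Fin n} {p : Subset n} → lookup p x ≡ true → x ∈ p
lookup⇒∈ {x = x} {p} = lookup⇒[]= x p

∉⇒lookup : {x : Fin n} {p : Subset n} → x ∉ p → lookup p x ≡ false
∉⇒lookup {x = x} {p} x∉p with lookup p x in eq
... | true  = contradiction (lookup⇒∈ eq) x∉p
... | false = refl

lookup-⊥ : (i : Fin n) → lookup (⊥ {n}) i ≡ false
lookup-⊥ i = lookup-replicate i false

lookup-⁅x⁆-x : (x : Fin n) → lookup ⁅ x ⁆ x ≡ true
lookup-⁅x⁆-x x = ∈⇒lookup (x∈⁅x⁆ x)

lookup-⁅x⁆-≢ : {x j : Fin n} → j ≢ x → lookup ⁅ x ⁆ j ≡ false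
lookup-⁅x⁆-≢ {x = x} j≢x = ∉⇒lookup (j≢x ∘ x∈⁅y⁆⇒x≡y x)

⁅⁆-injective : {x y : Fin n} → ⁅ x ⁆ ≡ ⁅ y ⁆ → x ≡ y
⁅⁆-injective {x = x} {y} eq = x∈⁅y⁆⇒x≡y y (lookup⇒∈ (trans (cong (λ p → lookup p x) (sym eq)) (lookup-⁅x⁆-x x)))

lookup-⊕ : (p q : Subset n) (i : Fin n) → lookup (p ⊕ q) i ≡ lookup p i xor lookup q i
lookup-⊕ p q i = lookup-zipWith _xor_ i p q

lookup-⊕⁅x⁆-x : (p : Subset n) (x : Fin n) → lookup (p ⊕ ⁅ x ⁆) x ≡ not (lookup p x)
lookup-⊕⁅x⁆-x p x = begin
  lookup (p ⊕ ⁅ x ⁆) x          ≡⟨ lookup-⊕ p ⁅ x ⁆ x ⟩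
  lookup p x xor lookup ⁅ x ⁆ x  ≡⟨ cong (lookup p x xor_) (lookup-⁅x⁆-x x) ⟩
  lookup p x xor true           ≡⟨ xor-comm (lookup p x) true ⟩
  not (lookup p x)              ∎
  where open ≡-Reasoning

lookup-⊕⁅x⁆-≢ : (p : Subset n) {x j : Fin n} → j ≢ x → lookup (p ⊕ ⁅ x ⁆) j ≡ lookup p j
lookup-⊕⁅x⁆-≢ p {x} {j} j≢x = trans (lookup-⊕ p ⁅ x ⁆ j) (trans (cong (lookup p j xor_) (lookup-⁅x⁆-≢ j≢x)) (xor-identityʳ _))

x∉p-x : (p : Subset n) (x : Fin n) → x ∉ p - x
x∉p-x (_ ∷ p) zero    ()
x∉p-x (_ ∷ p) (suc x) (there x∈p-x) = x∉p-x p x x∈p-x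

lookup-[p-x]-x : (p : Subset n) (x : Fin n) → lookup (p - x) x ≡ false
lookup-[p-x]-x p x = ∉⇒lookup (x∉p-x p x)

lookup-[p-x]-≢ : (p : Subset n) {x j : Fin n} → j ≢ x → lookup (p - x) j ≡ lookup p j
lookup-[p-x]-≢ p {x} {j} j≢x with lookup p j in eq
... | true  = ∈⇒lookup (x∈p∧x≢y⇒x∈p-y {p = p} (lookup⇒∈ eq) j≢x)
... | false = ∉⇒lookup (λ j∈p-x → contradiction (trans (sym (∈⇒lookup (p─q⊆p p ⁅ x ⁆ j∈p-x))) eq) λ ())

p-x≡p⊕⁅x⁆ : {p : Subset n} {x : Fin n} → x ∈ p → p - x ≡ p ⊕ ⁅ x ⁆
p-x≡p⊕⁅x⁆ {p = p} {x} x∈p = subset-ext pointwise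
  where
  pointwise : ∀ j → lookup (p - x) j ≡ lookup (p ⊕ ⁅ x ⁆) j
  pointwise j with j ≟ x
  ... | yes refl = trans (lookup-[p-x]-x p x) (sym (trans (lookup-⊕⁅x⁆-x p x) (cong not (∈⇒lookup x∈p))))
  ... | no j≢x   = trans (lookup-[p-x]-≢ p j≢x) (sym (lookup-⊕⁅x⁆-≢ p j≢x))

⊕-assoc : (p q r : Subset n) → (p ⊕ q) ⊕ r ≡ p ⊕ (q ⊕ r)
⊕-assoc p q r = Pointwise-≡⇒≡ (zipWith-assoc xor-assoc p q r)

⊕-identityˡ : (p : Subset n) → ⊥ ⊕ p ≡ p
⊕-identityˡ p = Pointwise-≡⇒≡ (zipWith-identityˡ xor-identityˡ p)

⊕-identityʳ : (p : Subset n) → p ⊕ ⊥ ≡ p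
⊕-identityʳ p = Pointwise-≡⇒≡ (zipWith-identityʳ xor-identityʳ p)

⊕-self : (p : Subset n) → p ⊕ p ≡ ⊥
⊕-self p = subset-ext λ i → trans (lookup-⊕ p p i) (trans (xor-same (lookup p i)) (sym (lookup-⊥ i)))

⊕-cancelˡ : (p q : Subset n) → p ⊕ (p ⊕ q) ≡ q
⊕-cancelˡ p q = begin
  p ⊕ (p ⊕ q)  ≡⟨ ⊕-assoc p p q ⟨
  (p ⊕ p) ⊕ q  ≡⟨ cong (_⊕ q) (⊕-self p) ⟩
  ⊥ ⊕ q        ≡⟨ ⊕-identityˡ q ⟩
  q            ∎
  where open ≡-Reasoning

⊕-cancelʳ : (p q : Subset n) → (p ⊕ q) ⊕ q ≡ p
⊕-cancelʳ p q = begin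
  (p ⊕ q) ⊕ q  ≡⟨ ⊕-assoc p q q ⟩
  p ⊕ (q ⊕ q)  ≡⟨ cong (p ⊕_) (⊕-self q) ⟩
  p ⊕ ⊥        ≡⟨ ⊕-identityʳ p ⟩
  p            ∎
  where open ≡-Reasoning

[p-x]⊕⁅x⁆≡p : {p : Subset n} {x : Fin n} → x ∈ p → (p - x) ⊕ ⁅ x ⁆ ≡ p
[p-x]⊕⁅x⁆≡p {p = p} {x} x∈p = trans (cong (_⊕ ⁅ x ⁆) (p-x≡p⊕⁅x⁆ x∈p)) (⊕-cancelʳ p ⁅ x ⁆)

p-x≡⊥⇒p≡⁅x⁆ : {p : Subset n} {x : Fin n} → x ∈ p → p - x ≡ ⊥ → p ≡ ⁅ x ⁆
p-x≡⊥⇒p≡⁅x⁆ {p = p} {x} x∈p p-x≡⊥ = begin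
  p                  ≡⟨ [p-x]⊕⁅x⁆≡p x∈p ⟨
  (p - x) ⊕ ⁅ x ⁆    ≡⟨ cong (_⊕ ⁅ x ⁆) p-x≡⊥ ⟩
  ⊥ ⊕ ⁅ x ⁆          ≡⟨ ⊕-identityˡ ⁅ x ⁆ ⟩
  ⁅ x ⁆              ∎
  where open ≡-Reasoning

p∪⁅x⁆≡p⊕⁅x⁆ : {p : Subset n} {x : Fin n} → x ∉ p → p ∪ ⁅ x ⁆ ≡ p ⊕ ⁅ x ⁆
p∪⁅x⁆≡p⊕⁅x⁆ {p = p} {x} x∉p = subset-ext pointwise
  where
  pointwise : ∀ j → lookup (p ∪ ⁅ x ⁆) j ≡ lookup (p ⊕ ⁅ x ⁆) j
  pointwise j with j ≟ x
  ... | yes refl = begin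
    lookup (p ∪ ⁅ x ⁆) x           ≡⟨ lookup-zipWith _ x p ⁅ x ⁆ ⟩
    lookup p x ∨ lookup ⁅ x ⁆ x    ≡⟨ cong₂ _∨_ (∉⇒lookup x∉p) (lookup-⁅x⁆-x x) ⟩
    true                           ≡⟨ cong not (∉⇒lookup x∉p) ⟨
    not (lookup p x)               ≡⟨ lookup-⊕⁅x⁆-x p x ⟨
    lookup (p ⊕ ⁅ x ⁆) x           ∎
    where open ≡-Reasoning
  ... | no j≢x = begin
    lookup (p ∪ ⁅ x ⁆) j           ≡⟨ lookup-zipWith _ j p ⁅ x ⁆ ⟩
    lookup p j ∨ lookup ⁅ x ⁆ j    ≡⟨ cong (lookup p j ∨_) (lookup-⁅x⁆-≢ j≢x) ⟩
    lookup p j ∨ false             ≡⟨ ∨-identityʳ (lookup p j) ⟩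
    lookup p j                     ≡⟨ lookup-⊕⁅x⁆-≢ p j≢x ⟨
    lookup (p ⊕ ⁅ x ⁆) j           ∎
    where open ≡-Reasoning

p⊆q⊕[p∩∁q] : (p q : Subset n) → p ⊆ q ⊕ (p ∩ ∁ q)
p⊆q⊕[p∩∁q] (true ∷ p) (true  ∷ q) here        = here
p⊆q⊕[p∩∁q] (true ∷ p) (false ∷ q) here        = here
p⊆q⊕[p∩∁q] (_    ∷ p) (_     ∷ q) (there x∈p) = there (p⊆q⊕[p∩∁q] p q x∈p)

toggles-after-two-removals : {S T : Subset n} {u w a b : Fin n} → u ∈ S → w ∈ S - u →
                             T ≡ (S - u) ⊕ ⁅ a ⁆ → T ≡ (S - w) ⊕ ⁅ b ⁆ → T ≡ S ⊎ T ≡ S - u - w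
toggles-after-two-removals {S = S} {T} {u} {w} {a} {b} u∈S w∈S-u T≡A T≡B with a ≟ u
... | yes refl = inj₁ (trans T≡A ([p-x]⊕⁅x⁆≡p u∈S))
... | no a≢u   = inj₂ (trans T≡A (trans (cong (λ x → (S - u) ⊕ ⁅ x ⁆) a≡w) (sym (p-x≡p⊕⁅x⁆ w∈S-u))))
  where
  -- Since a ≢ u, u is missing from T; so the second toggle must restore u, i.e. b ≡ u.
  -- Then w is missing from T, so the first toggle must restore w, i.e. a ≡ w.
  lookup-T : ∀ {p x j} → T ≡ p ⊕ ⁅ x ⁆ → j ≢ x → lookup T j ≡ lookup p j
  lookup-T {p} {x} {j} T≡p⊕⁅x⁆ j≢x = trans (cong (λ X → lookup X j) T≡p⊕⁅x⁆) (lookup-⊕⁅x⁆-≢ p j≢x)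

  u≢w : u ≢ w
  u≢w refl = x∉p-x S u w∈S-u

  u∉T : lookup T u ≡ false
  u∉T = trans (lookup-T T≡A (a≢u ∘ sym)) (lookup-[p-x]-x S u)

  u≡b : u ≡ b
  u≡b with u ≟ b
  ... | yes u≡b = u≡b
  ... | no  u≢b = contradiction (trans (sym u∉T) u∈T) λ ()
    where
    u∈T : lookup T u ≡ true
    u∈T = trans (lookup-T T≡B u≢b) (trans (lookup-[p-x]-≢ S u≢w) (∈⇒lookup u∈S))

  w∉T : lookup T w ≡ false
  w∉T = trans (lookup-T T≡B (λ w≡b → u≢w (trans u≡b (sym w≡b)))) (lookup-[p-x]-x S w)

  a≡w : a ≡ w
  a≡w with w ≟ a
  ... | yes w≡a = sym w≡a
  ... | no  w≢a = contradiction (trans (sym w∉T) w∈T) λ ()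
    where
    w∈T : lookup T w ≡ true
    w∈T = trans (lookup-T T≡A w≢a) (∈⇒lookup w∈S-u)

preimage : ∀ {m} → (Fin m → Fin n) → Subset n → Subset m
preimage σ p = tabulate (lookup p ∘ σ)

lookup-preimage : ∀ {m} (σ : Fin m → Fin n) (p : Subset n) (i : Fin m) → lookup (preimage σ p) i ≡ lookup p (σ i)
lookup-preimage σ p = lookup∘tabulate (lookup p ∘ σ)

preimage-zipWith : ∀ {m} (σ : Fin m → Fin n) (f : Bool → Bool → Bool) (p q : Subset n) →
                   preimage σ (zipWith f p q) ≡ zipWith f (preimage σ p) (preimage σ q)
preimage-zipWith σ f p q = subset-ext λ i → begin
  lookup (preimage σ (zipWith f p q)) i                     ≡⟨ lookup-preimage σ (zipWith f p q) i ⟩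
  lookup (zipWith f p q) (σ i)                              ≡⟨ lookup-zipWith f (σ i) p q ⟩
  f (lookup p (σ i)) (lookup q (σ i))                       ≡⟨ cong₂ f (lookup-preimage σ p i) (lookup-preimage σ q i) ⟨
  f (lookup (preimage σ p) i) (lookup (preimage σ q) i)     ≡⟨ lookup-zipWith f i (preimage σ p) (preimage σ q) ⟨
  lookup (zipWith f (preimage σ p) (preimage σ q)) i        ∎
  where open ≡-Reasoning

preimage-⊕ : ∀ {m} (σ : Fin m → Fin n) (p q : Subset n) → preimage σ (p ⊕ q) ≡ preimage σ p ⊕ preimage σ q
preimage-⊕ σ = preimage-zipWith σ _xor_

preimage-∩ : ∀ {m} (σ : Fin m → Fin n) (p q : Subset n) → preimage σ (p ∩ q) ≡ preimage σ p ∩ preimage σ q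
preimage-∩ σ = preimage-zipWith σ _∧_

preimage-∁ : ∀ {m} (σ : Fin m → Fin n) (p : Subset n) → preimage σ (∁ p) ≡ ∁ (preimage σ p)
preimage-∁ σ p = subset-ext λ i → begin
  lookup (preimage σ (∁ p)) i     ≡⟨ lookup-preimage σ (∁ p) i ⟩
  lookup (∁ p) (σ i)              ≡⟨ lookup-map (σ i) not p ⟩
  not (lookup p (σ i))            ≡⟨ cong not (lookup-preimage σ p i) ⟨
  not (lookup (preimage σ p) i)   ≡⟨ lookup-map i not (preimage σ p) ⟨
  lookup (∁ (preimage σ p)) i     ∎
  where open ≡-Reasoning

preimage-⊥ : ∀ {m} (σ : Fin m → Fin n) → preimage σ ⊥ ≡ ⊥
preimage-⊥ σ = subset-ext λ i → trans (lookup-preimage σ ⊥ i) (trans (lookup-⊥ (σ i)) (sym (lookup-⊥ i)))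

preimage-⁅⁆ : ∀ {m} {σ : Fin m → Fin n} → Injective _≡_ _≡_ σ → (x : Fin m) → preimage σ ⁅ σ x ⁆ ≡ ⁅ x ⁆
preimage-⁅⁆ {σ = σ} σ-injective x = subset-ext pointwise
  where
  pointwise : ∀ j → lookup (preimage σ ⁅ σ x ⁆) j ≡ lookup ⁅ x ⁆ j
  pointwise j with j ≟ x
  ... | yes refl = trans (lookup-preimage σ ⁅ σ x ⁆ x) (trans (lookup-⁅x⁆-x (σ x)) (sym (lookup-⁅x⁆-x x)))
  ... | no j≢x   = trans (lookup-preimage σ ⁅ σ x ⁆ j) (trans (lookup-⁅x⁆-≢ (j≢x ∘ σ-injective)) (sym (lookup-⁅x⁆-≢ j≢x)))

preimage-preimage : ∀ {m k} (σ : Fin m → Fin n) (τ : Fin k → Fin m) (p : Subset n) →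
                    preimage τ (preimage σ p) ≡ preimage (σ ∘ τ) p
preimage-preimage σ τ p = subset-ext λ i → trans (lookup-preimage τ (preimage σ p) i) (trans (lookup-preimage σ p (τ i)) (sym (lookup-preimage (σ ∘ τ) p i)))

module _ (σ : Fin n ↔ Fin n') where
  open Inverse σ using (to; from; strictlyInverseˡ; strictlyInverseʳ)

  lookup-image : (p : Subset n) (x : Fin n) → lookup (image σ p) (to x) ≡ lookup p x
  lookup-image p x = trans (lookup-preimage from p (to x)) (cong (lookup p) (strictlyInverseʳ x))

  image-⊆⁻ : {p q : Subset n} → image σ p ⊆ image σ q → p ⊆ q
  image-⊆⁻ {p} {q} σp⊆σq {x} x∈p = lookup⇒∈ (trans (sym (lookup-image q x))
    (∈⇒lookup (σp⊆σq (lookup⇒∈ (trans (lookup-image p x) (∈⇒lookup x∈p))))))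

  image-preimage : (p : Subset n') → image σ (preimage to p) ≡ p
  image-preimage p = trans (preimage-preimage to from p)
    (subset-ext λ j → trans (lookup-preimage (to ∘ from) p j) (cong (lookup p) (strictlyInverseˡ j)))

  image-∩∁preimage : (p : Subset n) (q : Subset n') → image σ (p ∩ ∁ (preimage to q)) ≡ image σ p ∩ ∁ q
  image-∩∁preimage p q = begin
    image σ (p ∩ ∁ (preimage to q))                   ≡⟨ preimage-∩ from p _ ⟩
    image σ p ∩ preimage from (∁ (preimage to q))     ≡⟨ cong (image σ p ∩_) (preimage-∁ from (preimage to q)) ⟩
    image σ p ∩ ∁ (image σ (preimage to q))           ≡⟨ cong (λ r → image σ p ∩ ∁ r) (image-preimage q) ⟩
    image σ p ∩ ∁ q                                   ∎
    where open ≡-Reasoning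

-- TARAdj, restated: q is p with the membership of x flipped.
Adjacent : Subset n → Subset n → Set
Adjacent p q = ∃[ x ] q ≡ p ⊕ ⁅ x ⁆

⊥-adjacent-⁅x⁆ : (x : Fin n) → Adjacent ⊥ ⁅ x ⁆
⊥-adjacent-⁅x⁆ x = x , sym (⊕-identityˡ ⁅ x ⁆)

p-x-adjacent-p : {p : Subset n} {x : Fin n} → x ∈ p → Adjacent (p - x) p
p-x-adjacent-p x∈p = _ , sym ([p-x]⊕⁅x⁆≡p x∈p)

record IsSimplicialComplex (F : Subset n → Set) : Set where
  field
    hereditary  : ∀ {S T} → T ⊆ S → F S → F T
    contains-⊥  : F ⊥
    contains-⁅⁆ : ∀ x → F ⁅ x ⁆

  contains-[p-x] : ∀ {S} (x : Fin n) → F S → F (S - x)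
  contains-[p-x] {S} x = hereditary (p─q⊆p S ⁅ x ⁆)

record TARIsomorphism (F : Subset n → Set) (F' : Subset n' → Set) : Set where
  field
    to            : Subset n → Subset n'
    from          : Subset n' → Subset n
    to-closed     : ∀ {S} → F S → F' (to S)
    from-closed   : ∀ {T} → F' T → F (from T)
    from∘to       : ∀ {S} → F S → from (to S) ≡ S
    to∘from       : ∀ {T} → F' T → to (from T) ≡ T
    to-adjacent   : ∀ {S S'} → F S → F S' → Adjacent S S' → Adjacent (to S) (to S')
    from-adjacent : ∀ {T T'} → F' T → F' T' → Adjacent T T' → Adjacent (from T) (from T')

  to-injective : ∀ {S S'} → F S → F S' → to S ≡ to S' → S ≡ S'
  to-injective FS FS' eq = trans (sym (from∘to FS)) (trans (cong from eq) (from∘to FS'))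

  inverse : TARIsomorphism F' F
  inverse = record
    { to = from ; from = to ; to-closed = from-closed ; from-closed = to-closed
    ; from∘to = to∘from ; to∘from = from∘to
    ; to-adjacent = from-adjacent ; from-adjacent = to-adjacent }

module _ {F : Subset n → Set} (F-complex : IsSimplicialComplex F) (h : Subset n → Subset n)
         (h-injective : ∀ {S S'} → F S → F S' → h S ≡ h S' → S ≡ S')
         (h-adjacent : ∀ {S S'} → F S → F S' → Adjacent S S' → Adjacent (h S) (h S'))
         (h-⊥ : h ⊥ ≡ ⊥) (h-⁅⁆ : ∀ x → h ⁅ x ⁆ ≡ ⁅ x ⁆) where
  open IsSimplicialComplex F-complex

  private
    FixedBelow : Subset n → Set
    FixedBelow S = ∀ {T} → T ⊂ S → F T → h T ≡ T

    toggle-after-removal : ∀ {S x} → FixedBelow S → F S → x ∈ S → ∃[ a ] h S ≡ (S - x) ⊕ ⁅ a ⁆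
    toggle-after-removal {S} {x} fixed FS x∈S =
      let a , hS≡h[S-x]⊕⁅a⁆ = h-adjacent (contains-[p-x] x FS) FS (p-x-adjacent-p x∈S)
      in  a , trans hS≡h[S-x]⊕⁅a⁆ (cong (_⊕ ⁅ a ⁆) (fixed (x∈p⇒p-x⊂p x∈S) (contains-[p-x] x FS)))

    fixed-if-two-elements : ∀ {S u w} → FixedBelow S → F S → u ∈ S → w ∈ S - u → h S ≡ S
    fixed-if-two-elements {S} {u} {w} fixed FS u∈S w∈S-u
      with toggles-after-two-removals u∈S w∈S-u (proj₂ (toggle-after-removal fixed FS u∈S))
                                                 (proj₂ (toggle-after-removal fixed FS (p─q⊆p S ⁅ u ⁆ w∈S-u)))
    ... | inj₁ hS≡S     = hS≡S
    ... | inj₂ hS≡S-u-w = contradiction (subst (u ∈_) S≡S-u-w u∈S) (x∉p-x S u ∘ p─q⊆p (S - u) ⁅ w ⁆)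
      where
      F[S-u-w] : F (S - u - w)
      F[S-u-w] = contains-[p-x] w (contains-[p-x] u FS)

      S≡S-u-w : S ≡ S - u - w
      S≡S-u-w = h-injective FS F[S-u-w]
        (trans hS≡S-u-w (sym (fixed (⊂-trans (x∈p⇒p-x⊂p w∈S-u) (x∈p⇒p-x⊂p u∈S)) F[S-u-w])))

  TAR-rigidity : ∀ {S} → F S → h S ≡ S
  TAR-rigidity {S} = rigid S (⊂-wellFounded S)
    where
    rigid : ∀ S → Acc _⊂_ S → F S → h S ≡ S
    rigid S (acc smaller) FS with nonempty? S
    ... | no S-empty = subst (λ T → h T ≡ T) (sym (Empty-unique S-empty)) h-⊥
    ... | yes (u , u∈S) with nonempty? (S - u)
    ...   | no S-u-empty    = subst (λ T → h T ≡ T) (sym (p-x≡⊥⇒p≡⁅x⁆ u∈S (Empty-unique S-u-empty))) (h-⁅⁆ u)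
    ...   | yes (w , w∈S-u) = fixed-if-two-elements (λ T⊂S → rigid _ (smaller T⊂S)) FS u∈S w∈S-u

injections⇒surjective : ∀ {m k} {σ : Fin m → Fin k} {τ : Fin k → Fin m} →
                        Injective _≡_ _≡_ σ → Injective _≡_ _≡_ τ → ∀ j → ∃[ i ] σ i ≡ j
injections⇒surjective {m} {suc k} {σ} σ-injective τ-injective j with any? (λ i → σ i ≟ j)
... | yes hit = hit
... | no  miss = contradiction (≤-trans (injective⇒≤ τ-injective) (injective⇒≤ σ'-injective)) (<-irrefl refl)
  where
  σ≢j : ∀ i → j ≢ σ i
  σ≢j i j≡σi = miss (i , sym j≡σi)

  σ' : Fin m → Fin k
  σ' i = punchOut (σ≢j i)

  σ'-injective : Injective _≡_ _≡_ σ'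
  σ'-injective eq = σ-injective (punchOut-injective (σ≢j _) (σ≢j _) eq)

module Coordinates {F : Subset n → Set} {F' : Subset n' → Set}
         (F-complex : IsSimplicialComplex F) (φ : TARIsomorphism F F') where
  open TARIsomorphism φ
  open IsSimplicialComplex F-complex

  origin : Subset n'
  origin = to ⊥

  private
    to-⁅⁆-adjacent : ∀ x → Adjacent origin (to ⁅ x ⁆)
    to-⁅⁆-adjacent x = to-adjacent contains-⊥ (contains-⁅⁆ x) (⊥-adjacent-⁅x⁆ x)

  coordinate : Fin n → Fin n'
  coordinate x = proj₁ (to-⁅⁆-adjacent x)

  to-⁅⁆ : ∀ x → to ⁅ x ⁆ ≡ origin ⊕ ⁅ coordinate x ⁆
  to-⁅⁆ x = proj₂ (to-⁅⁆-adjacent x)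

  coordinate-injective : Injective _≡_ _≡_ coordinate
  coordinate-injective {x} {y} eq = ⁅⁆-injective (to-injective (contains-⁅⁆ x) (contains-⁅⁆ y) (begin
    to ⁅ x ⁆                      ≡⟨ to-⁅⁆ x ⟩
    origin ⊕ ⁅ coordinate x ⁆     ≡⟨ cong (λ z → origin ⊕ ⁅ z ⁆) eq ⟩
    origin ⊕ ⁅ coordinate y ⁆     ≡⟨ to-⁅⁆ y ⟨
    to ⁅ y ⁆                      ∎))
    where open ≡-Reasoning

module Reconstruction {F : Subset n → Set} {F' : Subset n' → Set}
         (F-complex : IsSimplicialComplex F) (F'-complex : IsSimplicialComplex F')
         (φ : TARIsomorphism F F') where
  open TARIsomorphism φ
  open IsSimplicialComplex F-complex
  open Coordinates F-complex φ
  private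
    module F' = IsSimplicialComplex F'-complex
    open Coordinates F'-complex inverse using () renaming (coordinate-injective to coordinate⁻¹-injective)

  coordinate-surjective : ∀ j → ∃[ i ] coordinate i ≡ j
  coordinate-surjective = injections⇒surjective coordinate-injective coordinate⁻¹-injective

  σ : Fin n ↔ Fin n'
  σ = mk↔ₛ′ coordinate (proj₁ ∘ coordinate-surjective) (proj₂ ∘ coordinate-surjective)
            (λ i → coordinate-injective (proj₂ (coordinate-surjective (coordinate i))))

  -- Inverse of the map S ↦ origin ⊕ image σ S, which agrees with to on ⊥ and on singletons.
  decode : Subset n' → Subset n
  decode T = preimage coordinate (origin ⊕ T)

  origin⊕image-decode : ∀ T → origin ⊕ image σ (decode T) ≡ T
  origin⊕image-decode T = trans (cong (origin ⊕_) (image-preimage σ (origin ⊕ T))) (⊕-cancelˡ origin T)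

  decode-injective : ∀ {T T'} → decode T ≡ decode T' → T ≡ T'
  decode-injective {T} {T'} eq = begin
    T                                ≡⟨ origin⊕image-decode T ⟨
    origin ⊕ image σ (decode T)      ≡⟨ cong (λ p → origin ⊕ image σ p) eq ⟩
    origin ⊕ image σ (decode T')     ≡⟨ origin⊕image-decode T' ⟩
    T'                               ∎
    where open ≡-Reasoning

  decode∘to-adjacent : ∀ {S S'} → F S → F S' → Adjacent S S' → Adjacent (decode (to S)) (decode (to S'))
  decode∘to-adjacent {S} {S'} FS FS' S~S' with to-adjacent FS FS' S~S'
  ... | x , toS'≡ with coordinate-surjective x
  ... | a , refl = a , (begin
    preimage coordinate (origin ⊕ to S')                           ≡⟨ cong (preimage coordinate ∘ (origin ⊕_)) toS'≡ ⟩
    preimage coordinate (origin ⊕ (to S ⊕ ⁅ coordinate a ⁆))       ≡⟨ cong (preimage coordinate) (⊕-assoc origin (to S) _) ⟨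
    preimage coordinate ((origin ⊕ to S) ⊕ ⁅ coordinate a ⁆)       ≡⟨ preimage-⊕ coordinate (origin ⊕ to S) _ ⟩
    decode (to S) ⊕ preimage coordinate ⁅ coordinate a ⁆          ≡⟨ cong (decode (to S) ⊕_) (preimage-⁅⁆ coordinate-injective a) ⟩
    decode (to S) ⊕ ⁅ a ⁆                                        ∎)
    where open ≡-Reasoning

  decode∘to-injective : ∀ {S S'} → F S → F S' → decode (to S) ≡ decode (to S') → S ≡ S'
  decode∘to-injective FS FS' = to-injective FS FS' ∘ decode-injective

  decode∘to-⊥ : decode (to ⊥) ≡ ⊥
  decode∘to-⊥ = trans (cong (preimage coordinate) (⊕-self origin)) (preimage-⊥ coordinate)

  decode∘to-⁅⁆ : ∀ x → decode (to ⁅ x ⁆) ≡ ⁅ x ⁆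
  decode∘to-⁅⁆ x = begin
    preimage coordinate (origin ⊕ to ⁅ x ⁆)                     ≡⟨ cong (preimage coordinate ∘ (origin ⊕_)) (to-⁅⁆ x) ⟩
    preimage coordinate (origin ⊕ (origin ⊕ ⁅ coordinate x ⁆))  ≡⟨ cong (preimage coordinate) (⊕-cancelˡ origin _) ⟩
    preimage coordinate ⁅ coordinate x ⁆                        ≡⟨ preimage-⁅⁆ coordinate-injective x ⟩
    ⁅ x ⁆                                                       ∎
    where open ≡-Reasoning

  to-affine : ∀ {S} → F S → to S ≡ origin ⊕ image σ S
  to-affine {S} FS = begin
    to S                               ≡⟨ origin⊕image-decode (to S) ⟨
    origin ⊕ image σ (decode (to S))   ≡⟨ cong (λ p → origin ⊕ image σ p) decode∘to≡id ⟩
    origin ⊕ image σ S                 ∎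
    where
    open ≡-Reasoning
    decode∘to≡id : decode (to S) ≡ S
    decode∘to≡id = TAR-rigidity F-complex (decode ∘ to) decode∘to-injective decode∘to-adjacent decode∘to-⊥ decode∘to-⁅⁆ FS

  image-closed : ∀ {S} → F S → F' (image σ S)
  image-closed {S} FS = F'.hereditary image⊆to[U] (to-closed FU)
    where
    U : Subset n
    U = S ∩ ∁ (preimage coordinate origin)
    FU : F U
    FU = hereditary (p∩q⊆p S _) FS
    image⊆to[U] : image σ S ⊆ to U
    image⊆to[U] = subst (image σ S ⊆_)
      (sym (trans (to-affine FU) (cong (origin ⊕_) (image-∩∁preimage σ S origin))))
      (p⊆q⊕[p∩∁q] (image σ S) origin)

  image-closed⁻ : ∀ {S} → F' (image σ S) → F S
  image-closed⁻ {S} F'σS = hereditary (image-⊆⁻ σ σS⊆σU) (from-closed F'W)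
    where
    W : Subset n'
    W = image σ S ∩ ∁ origin
    F'W : F' W
    F'W = F'.hereditary (p∩q⊆p (image σ S) _) F'σS
    σU≡ : image σ (from W) ≡ origin ⊕ W
    σU≡ = begin
      image σ (from W)                        ≡⟨ ⊕-cancelˡ origin _ ⟨
      origin ⊕ (origin ⊕ image σ (from W))    ≡⟨ cong (origin ⊕_) (to-affine (from-closed F'W)) ⟨
      origin ⊕ to (from W)                    ≡⟨ cong (origin ⊕_) (to∘from F'W) ⟩
      origin ⊕ W                              ∎
      where open ≡-Reasoning
    σS⊆σU : image σ S ⊆ image σ (from W)
    σS⊆σU = subst (image σ S ⊆_) (sym σU≡) (p⊆q⊕[p∩∁q] (image σ S) origin)

  reconstruction : n ≡ n' × Σ (Fin n ↔ Fin n') λ τ → ∀ S → F S ⇔ F' (image τ S)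
  reconstruction = cantor-schröder-bernstein coordinate-injective coordinate⁻¹-injective
                 , σ , λ S → mk⇔ image-closed image-closed⁻

select : {P : Fin n → Set} → Decidable P → Subset n
select P? = tabulate (does ∘ P?)

∈-select⁺ : {P : Fin n → Set} (P? : Decidable P) {x : Fin n} → P x → x ∈ select P?
∈-select⁺ P? {x} Px = lookup⇒∈ (trans (lookup∘tabulate (does ∘ P?) x) (dec-true (P? x) Px))

∈-select⁻ : {P : Fin n → Set} (P? : Decidable P) {x : Fin n} → x ∈ select P? → P x
∈-select⁻ P? {x} x∈ with P? x | lookup∘tabulate (does ∘ P?) x
... | yes Px | _   = Px
... | no  _  | eq  = contradiction (trans (sym eq) (∈⇒lookup x∈)) λ ()

members : (p : Subset n) → Fin ∣ p ∣ → Fin n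
members (true  ∷ p) zero    = zero
members (true  ∷ p) (suc i) = suc (members p i)
members (false ∷ p) i       = suc (members p i)

members-∈ : (p : Subset n) (i : Fin ∣ p ∣) → members p i ∈ p
members-∈ (true  ∷ p) zero    = here
members-∈ (true  ∷ p) (suc i) = there (members-∈ p i)
members-∈ (false ∷ p) i       = there (members-∈ p i)

members-injective : (p : Subset n) → Injective _≡_ _≡_ (members p)
members-injective (true  ∷ p) {zero}  {zero}  _  = refl
members-injective (true  ∷ p) {suc i} {suc j} eq = cong suc (members-injective p (suc-injective eq))
members-injective (false ∷ p)                 eq = members-injective p (suc-injective eq)

members-surjective : (p : Subset n) {x : Fin n} → x ∈ p → ∃[ i ] members p i ≡ x
members-surjective (true  ∷ p) here        = zero , refl
members-surjective (true  ∷ p) (there x∈p) = let i , eq = members-surjective p x∈p in suc i , cong suc eq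
members-surjective (false ∷ p) (there x∈p) = let i , eq = members-surjective p x∈p in i , cong suc eq

module _ {G : Graph} where
  reach-snoc : ∀ {a b c} → Reach G a b → adj G b c ≡ true → Reach G a c
  reach-snoc here         b~c = step b~c here
  reach-snoc (step a~w r) b~c = step a~w (reach-snoc r b~c)

  reach-trans : ∀ {a b c} → Reach G a b → Reach G b c → Reach G a c
  reach-trans here         r' = r'
  reach-trans (step a~w r) r' = step a~w (reach-trans r r')

  reach-sym : ∀ {a b} → Reach G a b → Reach G b a
  reach-sym here                       = here
  reach-sym (step {u} {w} u~w r) = reach-snoc (reach-sym r) (trans (adj-sym G w u) u~w)

distinct⇒2≤ : ∀ {k} {i j : Fin k} → i ≢ j → 2 ≤ k
distinct⇒2≤ {suc zero}    {zero} {zero} i≢j = contradiction refl i≢j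
distinct⇒2≤ {suc (suc k)}               _   = s≤s (s≤s z≤n)

module ComponentOf (G : Graph) (v : V G) where
  Closed : Subset (order G) → Set
  Closed C = ∀ {w u} → w ∈ C → adj G w u ≡ true → u ∈ C

  grow? : (C : Subset (order G)) → Decidable (λ u → u ∈ C ⊎ ∃[ w ] (w ∈ C × adj G w u ≡ true))
  grow? C u = u ∈? C ⊎-dec any? (λ w → w ∈? C ×-dec adj G w u ≟ᵇ true)

  grow : Subset (order G) → Subset (order G)
  grow C = select (grow? C)

  ⊆-grow : ∀ C → C ⊆ grow C
  ⊆-grow C x∈C = ∈-select⁺ (grow? C) (inj₁ x∈C)

  grow-closed : ∀ {C} → Closed C → Closed (grow C)
  grow-closed {C} closed w∈ w~u = ⊆-grow C (closed (shrink w∈) w~u)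
    where
    shrink : grow C ⊆ C
    shrink x∈ with ∈-select⁻ (grow? C) x∈
    ... | inj₁ x∈C            = x∈C
    ... | inj₂ (w , w∈C , w~x) = closed w∈C w~x

  closed-or-grows : ∀ C → Closed C ⊎ C ⊂ grow C
  closed-or-grows C with any? (λ w → any? (λ u → (w ∈? C ×-dec adj G w u ≟ᵇ true) ×-dec ¬? (u ∈? C)))
  ... | yes (w , u , (w∈C , w~u) , u∉C) = inj₂ (⊆-grow C , u , ∈-select⁺ (grow? C) (inj₂ (w , w∈C , w~u)) , u∉C)
  ... | no  no-exit                     = inj₁ λ {w} {u} w∈C w~u →
    decidable-stable (u ∈? C) λ u∉C → no-exit (w , u , (w∈C , w~u) , u∉C)

  layer : ℕ → Subset (order G)
  layer zero    = ⁅ v ⁆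
  layer (suc k) = grow (layer k)

  v∈layer : ∀ k → v ∈ layer k
  v∈layer zero    = x∈⁅x⁆ v
  v∈layer (suc k) = ⊆-grow (layer k) (v∈layer k)

  layer-reaches : ∀ k {u} → u ∈ layer k → Reach G u v
  layer-reaches zero    u∈ with x∈⁅y⁆⇒x≡y v u∈
  ... | refl = here
  layer-reaches (suc k) u∈ with ∈-select⁻ (grow? (layer k)) u∈
  ... | inj₁ u∈layer             = layer-reaches k u∈layer
  ... | inj₂ (w , w∈layer , w~u) = step (trans (adj-sym G _ w) w~u) (layer-reaches k w∈layer)

  layer-closed-or-large : ∀ k → Closed (layer k) ⊎ k < ∣ layer k ∣
  layer-closed-or-large zero = inj₂ (≤-reflexive (sym (∣⁅x⁆∣≡1 v)))
  layer-closed-or-large (suc k) with closed-or-grows (layer k)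
  ... | inj₁ closed = inj₁ (grow-closed closed)
  ... | inj₂ grows with layer-closed-or-large k
  ...   | inj₁ closed = inj₁ (grow-closed closed)
  ...   | inj₂ large  = inj₂ (≤-trans (s≤s large) (p⊂q⇒∣p∣<∣q∣ grows))

  C : Subset (order G)
  C = layer (order G)

  C-closed : Closed C
  C-closed with layer-closed-or-large (order G)
  ... | inj₁ closed = closed
  ... | inj₂ large  = contradiction (∣p∣≤n C) (<⇒≱ large)

  C-reaches : ∀ {u} → u ∈ C → Reach G u v
  C-reaches = layer-reaches (order G)

  v∈C : v ∈ C
  v∈C = v∈layer (order G)

  v-index : Fin ∣ C ∣
  v-index = proj₁ (members-surjective C v∈C)

  members-v-index : members C v-index ≡ v
  members-v-index = proj₂ (members-surjective C v∈C)

  neighbour⇒2≤∣C∣ : ∀ {u} → adj G v u ≡ true → 2 ≤ ∣ C ∣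
  neighbour⇒2≤∣C∣ {u} v~u with members-surjective C (C-closed v∈C v~u)
  ... | u-index , members-u-index = distinct⇒2≤ v-index≢u-index
    where
    v-index≢u-index : v-index ≢ u-index
    v-index≢u-index eq = contradiction (trans (sym v~u) (trans (cong (adj G v) u≡v) (adj-irr G v))) λ ()
      where
      u≡v : u ≡ v
      u≡v = trans (sym members-u-index) (trans (cong (members C) (sym eq)) members-v-index)

  induced : Graph
  induced = record
    { order    = ∣ C ∣
    ; nonempty = >-nonZero⁻¹ ∣ C ∣ {{nonZeroIndex v-index}}
    ; adj      = λ i j → adj G (members C i) (members C j)
    ; adj-sym  = λ i j → adj-sym G (members C i) (members C j)
    ; adj-irr  = λ i → adj-irr G (members C i) }

  lift-reach : ∀ i {b} → Reach G (members C i) b → ∃[ j ] (members C j ≡ b × Reach induced i j)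
  lift-reach i here = i , refl , here
  lift-reach i (step i~w r) with members-surjective C (C-closed (members-∈ C i) i~w)
  ... | k , refl with lift-reach k r
  ...   | j , refl , r' = j , refl , step i~w r'

  induced-connected : Connected induced
  induced-connected i j with lift-reach i (reach-trans (C-reaches (members-∈ C i)) (reach-sym (C-reaches (members-∈ C j))))
  ... | j' , eq , r with members-injective C eq
  ...   | refl = r

  component : Component G
  component = record
    { H       = induced
    ; emb     = members C
    ; emb-inj = λ _ _ → members-injective C
    ; emb-adj = λ _ _ → refl
    ; H-conn  = induced-connected
    ; closed  = λ i _ i~u → members-surjective C (C-closed (members-∈ C i) i~u) }

isolated-or-neighbour : (G : Graph) (v : V G) → IsolatedVertex G v ⊎ ∃[ u ] adj G v u ≡ true
isolated-or-neighbour G v with any? (λ u → adj G v u ≟ᵇ true)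
... | yes neighbour    = inj₂ neighbour
... | no  no-neighbour = inj₁ λ u → ¬-not (no-neighbour ∘ (u ,_))

isolated-component : (G : Graph) {v : V G} → IsolatedVertex G v → Component G
isolated-component G {v} isolated = record
  { H       = K₁
  ; emb     = λ _ → v
  ; emb-inj = λ { zero zero _ → refl }
  ; emb-adj = λ { zero zero → sym (adj-irr G v) }
  ; H-conn  = λ { zero zero → here }
  ; closed  = λ _ u v~u → contradiction (trans (sym v~u) (isolated u)) λ () }

lifted? : ∀ {G} (c : Component G) R → Decidable (λ x → ∃[ i ] (emb c i ≡ x × i ∈ R))
lifted? c R x = any? (λ i → emb c i ≟ x ×-dec i ∈? R)

lift : ∀ {G} (c : Component G) → Subset (order (H c)) → Subset (order G)
lift c R = select (lifted? c R)

lift-IsLift : ∀ {G} (c : Component G) R → IsLift c R (lift c R)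
lift-IsLift c R x = mk⇔ (∈-select⁻ (lifted? c R)) (∈-select⁺ (lifted? c R))

⁅x⁆∩p≡⁅x⁆ : {p : Subset n} {x : Fin n} → x ∈ p → ⁅ x ⁆ ∩ p ≡ ⁅ x ⁆
⁅x⁆∩p≡⁅x⁆ {p = p} {x} x∈p = ⊆-antisym (p∩q⊆p ⁅ x ⁆ p)
  λ y∈⁅x⁆ → x∈p∩q⁺ (y∈⁅x⁆ , subst (_∈ p) (sym (x∈⁅y⁆⇒x≡y x y∈⁅x⁆)) x∈p)

private-∩-shrink : {S T R : Subset n} {u : Fin n} → T ⊆ S → u ∈ T → S ∩ R ≡ ⁅ u ⁆ → T ∩ R ≡ ⁅ u ⁆
private-∩-shrink {S = S} {T} {R} {u} T⊆S u∈T S∩R≡⁅u⁆ = ⊆-antisym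
  (λ {y} y∈T∩R → let y∈T , y∈R = x∈p∩q⁻ T R y∈T∩R in subst (y ∈_) S∩R≡⁅u⁆ (x∈p∩q⁺ (T⊆S y∈T , y∈R)))
  (λ {y} y∈⁅u⁆ → subst (_∈ T ∩ R) (sym (x∈⁅y⁆⇒x≡y u y∈⁅u⁆)) (x∈p∩q⁺ (u∈T , u∈R)))
  where
  u∈R : u ∈ R
  u∈R = proj₂ (x∈p∩q⁻ S R (subst (u ∈_) (sym S∩R≡⁅u⁆) (x∈⁅x⁆ u)))

module _ (X : SuperXParam) (𝓑 : BlockingFamily X) where
  open BlockingFamily 𝓑 using (B)

  XIr-hereditary : ∀ G {S T} → T ⊆ S → XIr X 𝓑 G S → XIr X 𝓑 G T
  XIr-hereditary G T⊆S S-XIr u u∈T =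
    let R , BR , S∩R≡⁅u⁆ = S-XIr u (T⊆S u∈T) in R , BR , private-∩-shrink T⊆S u∈T S∩R≡⁅u⁆

  XIr-⁅⁆ : ∀ G {R x} → B G R → x ∈ R → XIr X 𝓑 G ⁅ x ⁆
  XIr-⁅⁆ G {R} {x} BR x∈R u u∈⁅x⁆ with x∈⁅y⁆⇒x≡y x u∈⁅x⁆
  ... | refl = R , BR , ⁅x⁆∩p≡⁅x⁆ x∈R

  XIr-complex : ∀ G → (∀ v → ∃[ R ] (B G R × v ∈ R)) → IsSimplicialComplex (XIr X 𝓑 G)
  XIr-complex G blocked = record
    { hereditary  = XIr-hereditary G
    ; contains-⊥  = λ _ u∈⊥ → contradiction u∈⊥ ∉⊥
    ; contains-⁅⁆ = λ v → let R , BR , v∈R = blocked v in XIr-⁅⁆ G BR v∈R }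

  TARAdj⇒Adjacent : {p q : Subset n} → TARAdj X 𝓑 p q → Adjacent p q
  TARAdj⇒Adjacent {p = p} {q} (x , inj₁ (x∉p , q≡p∪⁅x⁆)) = x , trans q≡p∪⁅x⁆ (p∪⁅x⁆≡p⊕⁅x⁆ x∉p)
  TARAdj⇒Adjacent {p = p} {q} (x , inj₂ (x∉q , p≡q∪⁅x⁆)) = x , (begin
    q                     ≡⟨ ⊕-cancelʳ q ⁅ x ⁆ ⟨
    (q ⊕ ⁅ x ⁆) ⊕ ⁅ x ⁆   ≡⟨ cong (_⊕ ⁅ x ⁆) (trans p≡q∪⁅x⁆ (p∪⁅x⁆≡p⊕⁅x⁆ x∉q)) ⟨
    p ⊕ ⁅ x ⁆             ∎)
    where open ≡-Reasoning

  Adjacent⇒TARAdj : {p q : Subset n} → Adjacent p q → TARAdj X 𝓑 p q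
  Adjacent⇒TARAdj {p = p} {q} (x , q≡p⊕⁅x⁆) with x ∈? p
  ... | no  x∉p = x , inj₁ (x∉p , trans q≡p⊕⁅x⁆ (sym (p∪⁅x⁆≡p⊕⁅x⁆ x∉p)))
  ... | yes x∈p = x , inj₂ (x∉q , (begin
    p                     ≡⟨ ⊕-cancelʳ p ⁅ x ⁆ ⟨
    (p ⊕ ⁅ x ⁆) ⊕ ⁅ x ⁆   ≡⟨ cong (_⊕ ⁅ x ⁆) q≡p⊕⁅x⁆ ⟨
    q ⊕ ⁅ x ⁆             ≡⟨ p∪⁅x⁆≡p⊕⁅x⁆ x∉q ⟨
    q ∪ ⁅ x ⁆             ∎))
    where
    open ≡-Reasoning
    x∉q : x ∉ q
    x∉q x∈q = contradiction
      (trans (sym (∈⇒lookup x∈q)) (trans (cong (λ r → lookup r x) q≡p⊕⁅x⁆) (trans (lookup-⊕⁅x⁆-x p x) (cong not (∈⇒lookup x∈p)))))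
      λ ()

  TARIso⇒TARIsomorphism : ∀ {G G'} → TARIso X 𝓑 G G' → TARIsomorphism (XIr X 𝓑 G) (XIr X 𝓑 G')
  TARIso⇒TARIsomorphism tar = record
    { to = f ; from = g ; to-closed = f-XIr _ ; from-closed = g-XIr _
    ; from∘to = gf _ ; to∘from = fg _
    ; to-adjacent = λ FS FS' → TARAdj⇒Adjacent ∘ Equivalence.to (f-adj _ _ FS FS') ∘ Adjacent⇒TARAdj
    ; from-adjacent = λ {T} {T'} FT FT' → TARAdj⇒Adjacent ∘ Equivalence.from (f-adj _ _ (g-XIr T FT) (g-XIr T' FT'))
        ∘ subst₂ (TARAdj X 𝓑) (sym (fg T FT)) (sym (fg T' FT')) ∘ Adjacent⇒TARAdj }
    where open TARIso tar

  blocking-set-via-component : BComponentConsistent X 𝓑 → ∀ {G} (c : Component G) {R i} →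
                               B (H c) R → i ∈ R → ∃[ T ] (B G T × emb c i ∈ T)
  blocking-set-via-component (lift-blocking , _) {G} c {R} BR i∈R =
    lift c R , lift-blocking G c R BR (lift c R) (lift-IsLift c R) , ∈-select⁺ (lifted? c R) (_ , refl , i∈R)

  K₁-blocking-set : IsXIR X 𝓑 K₁ 1 → ∃[ R ] (B K₁ R × zero ∈ R)
  K₁-blocking-set ((false ∷ [] , _ , ()) , _)
  K₁-blocking-set ((true ∷ [] , S-XIr , _) , _) =
    let R , BR , S∩R≡⁅0⁆ = S-XIr zero here in
    R , BR , proj₂ (x∈p∩q⁻ (true ∷ []) R (subst (zero ∈_) (sym S∩R≡⁅0⁆) here))

  non-isolated-vertex-blocked : Inclusive X 𝓑 → ∀ G {v u} → adj G v u ≡ true → ∃[ R ] (B G R × v ∈ R)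
  non-isolated-vertex-blocked (cc , inclusive) G {v} v~u =
    let R , BR , v-index∈R   = inclusive induced induced-connected (neighbour⇒2≤∣C∣ v~u) v-index
        T , BT , members-v∈T = blocking-set-via-component cc component BR v-index∈R
    in  T , BT , subst (_∈ T) members-v-index members-v∈T
    where open ComponentOf G v

  isolated-vertex-blocked : BComponentConsistent X 𝓑 → IsXIR X 𝓑 K₁ 1 →
                            ∀ G {v} → IsolatedVertex G v → ∃[ R ] (B G R × v ∈ R)
  isolated-vertex-blocked cc XIR[K₁]≡1 G isolated =
    let R , BR , 0∈R = K₁-blocking-set XIR[K₁]≡1
    in  blocking-set-via-component cc (isolated-component G isolated) BR 0∈R

  vertex-blocked : Inclusive X 𝓑 → ∀ G → IsXIR X 𝓑 K₁ 1 ⊎ NoIsolatedVertices G →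
                   ∀ v → ∃[ R ] (B G R × v ∈ R)
  vertex-blocked inclusive G K₁-or-no-isolated v with isolated-or-neighbour G v | K₁-or-no-isolated
  ... | inj₂ (_ , v~u) | _                 = non-isolated-vertex-blocked inclusive G v~u
  ... | inj₁ isolated  | inj₁ XIR[K₁]≡1    = isolated-vertex-blocked (proj₁ inclusive) XIR[K₁]≡1 G isolated
  ... | inj₁ isolated  | inj₂ no-isolated  = contradiction isolated (no-isolated v)

theorem2p19 : (X : SuperXParam) → Robust X →
    (𝓑 : BlockingFamily X) → Inclusive X 𝓑 → Irredundant X 𝓑 →
    (G G' : Graph) → TARIso X 𝓑 G G' →
    (IsXIR X 𝓑 K₁ 1 ⊎ (NoIsolatedVertices G × NoIsolatedVertices G')) →
    (order G ≡ order G') ×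
    (Σ (Fin (order G) ↔ Fin (order G')) λ σ →
       ∀ (S : Subset (order G)) → XIr X 𝓑 G S ⇔ XIr X 𝓑 G' (image σ S))
theorem2p19 X _ 𝓑 inclusive _ G G' tar K₁-or-no-isolated =
  Reconstruction.reconstruction
    (XIr-complex X 𝓑 G  (vertex-blocked X 𝓑 inclusive G  (map₂ proj₁ K₁-or-no-isolated)))
    (XIr-complex X 𝓑 G' (vertex-blocked X 𝓑 inclusive G' (map₂ proj₂ K₁-or-no-isolated)))
    (TARIso⇒TARIsomorphism X 𝓑 tar)
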